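{- Let $n\geq1$ and let $\mathcal{L}$ be a laminar family of subsets of $\{1,\ldots,2n\}$, each of odd size. Then $|\mathcal{L}|\leq3n-1$.
   Context: A family $\mathcal{L}$ of subsets of a ground set is laminar if for all $U,W\in\mathcal{L}$ with $U\cap W\neq\emptyset$, we have $U\subseteq W$ or $W\subseteq U$. -}

module Defs where

open import Data.Nat using (ℕ; _+_; _*_)
open import Data.Fin.Subset using (Subset; _⊆_; _∩_; Nonempty; ∣_∣)
open import Data.Product using (∃; _×_)
open import Data.Sum using (_⊎_)
open import Data.List using (List)
open import Data.List.Membership.Propositional using (_∈_)
open import Relation.Binary.PropositionalEquality using (_≡_)

Odd : ℕ → Set
Odd m = ∃ λ k → m ≡ 2 * k + 1

Laminar : ∀ {m} → List (Subset m) → Set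
Laminar {m} ℒ = ∀ (U W : Subset m) → U ∈ ℒ → W ∈ ℒ →
  Nonempty (U ∩ W) → (U ⊆ W) ⊎ (W ⊆ U)

-- Induction on S shows, for every odd laminar family L of subsets of a nonempty S, that
-- 2|L| < 3|S|, and 2|L| + 1 < 3|S| when S ∉ L. If S ∉ L, a largest member R of L contains
-- every member that meets it, so L splits into a family inside R and one inside S ─ R, whose
-- bounds add up to the sharper one. If S ∈ L, removing S costs 2 on the left, which the
-- sharper bound pays for because 3|S| is odd while 2|L| is even.
module Submission where

open import Defs
open import Data.Nat using (ℕ; _+_; _*_; _∸_; _≤_; _<_; suc; s≤s)
open import Data.Nat.Properties
open import Data.Nat.Induction using (<-wellFounded)
open import Data.Nat.Tactic.RingSolver using (solve-∀)
open import Data.Bool.Properties using () renaming (_≟_ to _≟ᵇ_)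
open import Data.Vec.Properties using (≡-dec)
open import Data.Fin.Subset using (Subset; ∣_∣; _⊆_; _─_; ⊤; inside; outside)
  renaming (_∈_ to _∈ₛ_; _∉_ to _∉ₛ_)
open import Data.Fin.Subset.Properties
  using (_∈?_; _⊆?_; drop-∷-⊆; ⊆-antisym; ⊆⊤; ∣⊤∣≡n; p⊂q⇒∣p∣<∣q∣; x∈p∩q⁺; x∈p∧x∉q⇒x∈p─q)
open import Data.Vec using ([]; _∷_; here)
open import Data.List using (List; []; _∷_; length; filter)
open import Data.List.Properties using (filter-accept; filter-reject; filter-all)
open import Data.List.Extrema.Nat using (argmax; argmax-sel; f[⊥]≤f[argmax]; f[xs]≤f[argmax])
open import Data.List.Membership.Propositional using (_∈_; _∉_)
open import Data.List.Membership.DecPropositional using () renaming (_∈?_ to ∈?[_])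
open import Data.List.Membership.Propositional.Properties using (∈-filter⁻)
open import Data.List.Relation.Unary.Any using (here; there)
import Data.List.Relation.Unary.All as All
open import Data.List.Relation.Unary.AllPairs using (_∷_)
open import Data.List.Relation.Unary.Unique.Propositional using (Unique)
import Data.List.Relation.Unary.Unique.Propositional.Properties as Unique
open import Data.Product using (_,_; proj₁; proj₂; uncurry)
open import Data.Sum using (inj₁; inj₂; [_,_]′)
open import Function using (_∘_; _$_)
open import Induction.WellFounded using (Acc; acc)
open import Level using (Level)
open import Relation.Binary.Definitions using (DecidableEquality)
open import Relation.Binary.PropositionalEquality
open import Relation.Nullary using (¬_; yes; no; ¬?; contradiction)
open import Relation.Unary using (Pred; Decidable)

private
  variable
    a p : Level
    A : Set a
    m : ℕ

odd⇒0< : ∀ {k} → Odd k → 0 < k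
odd⇒0< (j , refl) = m≤n+m 1 (2 * j)

3*odd : ∀ {k} → Odd k → Odd (3 * k)
3*odd (j , refl) = 3 * j + 1 , lemma j
  where
  lemma : ∀ j → 3 * (2 * j + 1) ≡ 2 * (3 * j + 1) + 1
  lemma = solve-∀

1+2*x<odd⇒2*[1+x]<odd : ∀ {k} x → Odd k → suc (2 * x) < k → 2 * suc x < k
1+2*x<odd⇒2*[1+x]<odd {k} x (j , k≡2j+1) 2x+1<k = ≤∧≢⇒<
  (subst (_≤ k) (sym (*-suc 2 x)) 2x+1<k)
  (λ 2[x+1]≡k → even≢odd (suc x) j (trans 2[x+1]≡k (trans k≡2j+1 (+-comm (2 * j) 1))))

2*i<3*r⇒2*j<3*s⇒1+2*[i+j]<3*[r+s] : ∀ i j r s → 2 * i < 3 * r → 2 * j < 3 * s →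
                                     suc (2 * (i + j)) < 3 * (r + s)
2*i<3*r⇒2*j<3*s⇒1+2*[i+j]<3*[r+s] i j r s 2i<3r 2j<3s = begin
  2 + 2 * (i + j)            ≡⟨ lemma i j ⟩
  suc (2 * i) + suc (2 * j)  ≤⟨ +-mono-≤ 2i<3r 2j<3s ⟩
  3 * r + 3 * s              ≡⟨ *-distribˡ-+ 3 r s ⟨
  3 * (r + s)                ∎
  where
  open ≤-Reasoning
  lemma : ∀ i j → 2 + 2 * (i + j) ≡ suc (2 * i) + suc (2 * j)
  lemma = solve-∀

m<n⇒m≤n∸1 : ∀ {i j} → i < j → i ≤ j ∸ 1
m<n⇒m≤n∸1 (s≤s i≤j) = i≤j

q⊆p⇒∣q∣+∣p─q∣≡∣p∣ : {P Q : Subset m} → Q ⊆ P → ∣ Q ∣ + ∣ P ─ Q ∣ ≡ ∣ P ∣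
q⊆p⇒∣q∣+∣p─q∣≡∣p∣ {P = []}          {[]}          _   = refl
q⊆p⇒∣q∣+∣p─q∣≡∣p∣ {P = inside ∷ P}  {inside ∷ Q}  Q⊆P =
  cong suc (q⊆p⇒∣q∣+∣p─q∣≡∣p∣ (drop-∷-⊆ Q⊆P))
q⊆p⇒∣q∣+∣p─q∣≡∣p∣ {P = inside ∷ P}  {outside ∷ Q} Q⊆P =
  trans (+-suc ∣ Q ∣ ∣ P ─ Q ∣) (cong suc (q⊆p⇒∣q∣+∣p─q∣≡∣p∣ (drop-∷-⊆ Q⊆P)))
q⊆p⇒∣q∣+∣p─q∣≡∣p∣ {P = outside ∷ P} {outside ∷ Q} Q⊆P = q⊆p⇒∣q∣+∣p─q∣≡∣p∣ (drop-∷-⊆ Q⊆P)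
q⊆p⇒∣q∣+∣p─q∣≡∣p∣ {P = outside ∷ P} {inside ∷ Q}  Q⊆P with () ← Q⊆P here

p⊆q⇒∣q∣≤∣p∣⇒q⊆p : {P Q : Subset m} → P ⊆ Q → ∣ Q ∣ ≤ ∣ P ∣ → Q ⊆ P
p⊆q⇒∣q∣≤∣p∣⇒q⊆p {P = P} P⊆Q ∣Q∣≤∣P∣ {x} x∈Q with x ∈? P
... | yes x∈P = x∈P
... | no  x∉P = contradiction ∣Q∣≤∣P∣ (<⇒≱ (p⊂q⇒∣p∣<∣q∣ (P⊆Q , x , x∈Q , x∉P)))

p⊆q∧p≢q⇒∣p∣<∣q∣ : {P Q : Subset m} → P ⊆ Q → P ≢ Q → ∣ P ∣ < ∣ Q ∣
p⊆q∧p≢q⇒∣p∣<∣q∣ P⊆Q P≢Q =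
  ≰⇒> (λ ∣Q∣≤∣P∣ → P≢Q (⊆-antisym P⊆Q (p⊆q⇒∣q∣≤∣p∣⇒q⊆p P⊆Q ∣Q∣≤∣P∣)))

_≟ˢ_ : DecidableEquality (Subset m)
_≟ˢ_ = ≡-dec _≟ᵇ_

length-filter-≢ : (_≟_ : DecidableEquality A) {x : A} {xs : List A} → Unique xs → x ∈ xs →
                  length xs ≡ suc (length (filter (λ y → ¬? (y ≟ x)) xs))
length-filter-≢ _≟_ {x} {_ ∷ xs} (x∉xs ∷ _) (here refl) = cong suc $ sym $ begin
  length (filter x≢? (x ∷ xs))  ≡⟨ cong length (filter-reject x≢? (_$ refl)) ⟩
  length (filter x≢? xs)        ≡⟨ cong length (filter-all x≢? (All.map (_∘ sym) x∉xs)) ⟩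
  length xs                     ∎
  where
  open ≡-Reasoning
  x≢? = λ y → ¬? (y ≟ x)
length-filter-≢ _≟_ {x} {y ∷ xs} (y∉xs ∷ xs-unique) (there x∈xs) = begin
  suc (length xs)                       ≡⟨ cong suc (length-filter-≢ _≟_ xs-unique x∈xs) ⟩
  suc (suc (length (filter x≢? xs)))    ≡⟨ cong (suc ∘ length) (filter-accept x≢? (All.lookup y∉xs x∈xs)) ⟨
  suc (length (filter x≢? (y ∷ xs)))    ∎
  where
  open ≡-Reasoning
  x≢? = λ z → ¬? (z ≟ x)

length-filter+length-filter-¬ : {P : Pred A p} (P? : Decidable P) (xs : List A) →
  length (filter P? xs) + length (filter (¬? ∘ P?) xs) ≡ length xs
length-filter+length-filter-¬ P? [] = refl
length-filter+length-filter-¬ P? (x ∷ xs) with P? x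
... | yes _ = cong suc (length-filter+length-filter-¬ P? xs)
... | no  _ = trans (+-suc _ _) (cong suc (length-filter+length-filter-¬ P? xs))

argmax-∈ : (f : A → ℕ) (x : A) (xs : List A) → argmax f x xs ∈ x ∷ xs
argmax-∈ f x xs = [ here , there ]′ (argmax-sel f x xs)

argmax-maximal : (f : A → ℕ) (x : A) (xs : List A) {y : A} → y ∈ x ∷ xs → f y ≤ f (argmax f x xs)
argmax-maximal f x xs (here refl)  = f[⊥]≤f[argmax] {f = f} x xs
argmax-maximal f x xs (there y∈xs) = All.lookup (f[xs]≤f[argmax] {f = f} x xs) y∈xs

laminar-⊈-largest⇒disjoint : {L : List (Subset m)} {R U : Subset m} → Laminar L → R ∈ L →
  (∀ {W} → W ∈ L → ∣ W ∣ ≤ ∣ R ∣) → U ∈ L → ¬ U ⊆ R → ∀ {x} → x ∈ₛ U → x ∉ₛ R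
laminar-⊈-largest⇒disjoint {R = R} {U} laminar R∈L largest U∈L U⊈R {x} x∈U x∈R
  with laminar U R U∈L R∈L (x , x∈p∩q⁺ (x∈U , x∈R))
... | inj₁ U⊆R = U⊈R U⊆R
... | inj₂ R⊆U = U⊈R (p⊆q⇒∣q∣≤∣p∣⇒q⊆p R⊆U (largest U∈L))

record OddLaminarFamily (S : Subset m) (L : List (Subset m)) : Set where
  field
    unique  : Unique L
    laminar : Laminar L
    odd     : ∀ {U} → U ∈ L → Odd ∣ U ∣
    within  : ∀ {U} → U ∈ L → U ⊆ S

filter⁺ : {P : Pred (Subset m) p} (P? : Decidable P) {S T : Subset m} {L : List (Subset m)} →
  (∀ {U} → U ∈ L → P U → U ⊆ T) → OddLaminarFamily S L → OddLaminarFamily T (filter P? L)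
filter⁺ P? {L = L} within-T family = record
  { unique  = Unique.filter⁺ P? unique
  ; laminar = λ U W U∈ W∈ → laminar U W (∈L U∈) (∈L W∈)
  ; odd     = odd ∘ ∈L
  ; within  = uncurry within-T ∘ ∈-filter⁻ P?
  }
  where
  open OddLaminarFamily family
  ∈L : ∀ {U} → U ∈ filter P? L → U ∈ L
  ∈L = proj₁ ∘ ∈-filter⁻ P?

mutual
  odd-laminar-bound-acc : {S : Subset m} {L : List (Subset m)} → Acc _<_ ∣ S ∣ →
    OddLaminarFamily S L → 0 < ∣ S ∣ → 2 * length L < 3 * ∣ S ∣
  odd-laminar-bound-acc {S = S} {L} rec family 0<∣S∣ with ∈?[ _≟ˢ_ ] S L
  ... | no S∉L = <⇒≤ (odd-laminar-bound-∉ rec family 0<∣S∣ S∉L)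
  ... | yes S∈L = subst (λ l → 2 * l < 3 * ∣ S ∣) (sym (length-filter-≢ _≟ˢ_ unique S∈L))
    (1+2*x<odd⇒2*[1+x]<odd _ (3*odd (odd S∈L)) (odd-laminar-bound-∉ rec family′ 0<∣S∣ S∉L′))
    where
    open OddLaminarFamily family
    ≢S? = λ U → ¬? (U ≟ˢ S)
    family′ : OddLaminarFamily S (filter ≢S? L)
    family′ = filter⁺ ≢S? (λ U∈L _ → within U∈L) family
    S∉L′ : S ∉ filter ≢S? L
    S∉L′ S∈L′ = proj₂ (∈-filter⁻ ≢S? {xs = L} S∈L′) refl

  odd-laminar-bound-∉ : {S : Subset m} {L : List (Subset m)} → Acc _<_ ∣ S ∣ →
    OddLaminarFamily S L → 0 < ∣ S ∣ → S ∉ L → suc (2 * length L) < 3 * ∣ S ∣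
  odd-laminar-bound-∉ {L = []} _ _ 0<∣S∣ _ = ≤-trans (n≤1+n 2) (*-monoʳ-≤ 3 0<∣S∣)
  odd-laminar-bound-∉ {S = S} {L = L@(x ∷ xs)} (acc rec) family 0<∣S∣ S∉L = begin-strict
    suc (2 * length L)                       ≡⟨ cong (suc ∘ (2 *_)) (length-filter+length-filter-¬ ⊆R? L) ⟨
    suc (2 * (length inner + length outer))  <⟨ 2*i<3*r⇒2*j<3*s⇒1+2*[i+j]<3*[r+s]
                                                  (length inner) (length outer) ∣ R ∣ (∣ S ─ R ∣)
                                                  inner-bound outer-bound ⟩
    3 * (∣ R ∣ + ∣ S ─ R ∣)                   ≡⟨ cong (3 *_) ∣R∣+∣S─R∣≡∣S∣ ⟩
    3 * ∣ S ∣                                 ∎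
    where
    open ≤-Reasoning
    open OddLaminarFamily family
    R = argmax ∣_∣ x xs
    R∈L : R ∈ L
    R∈L = argmax-∈ ∣_∣ x xs
    ⊆R? = _⊆? R
    inner = filter ⊆R? L
    outer = filter (¬? ∘ ⊆R?) L
    inner-family : OddLaminarFamily R inner
    inner-family = filter⁺ ⊆R? (λ _ U⊆R → U⊆R) family
    outer-family : OddLaminarFamily (S ─ R) outer
    outer-family = filter⁺ (¬? ∘ ⊆R?) (λ U∈L U⊈R y∈U → x∈p∧x∉q⇒x∈p─q (within U∈L y∈U)
      (laminar-⊈-largest⇒disjoint laminar R∈L (argmax-maximal ∣_∣ x xs) U∈L U⊈R y∈U)) family
    ∣R∣+∣S─R∣≡∣S∣ : ∣ R ∣ + ∣ S ─ R ∣ ≡ ∣ S ∣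
    ∣R∣+∣S─R∣≡∣S∣ = q⊆p⇒∣q∣+∣p─q∣≡∣p∣ (within R∈L)
    0<∣R∣ : 0 < ∣ R ∣
    0<∣R∣ = odd⇒0< (odd R∈L)
    ∣R∣<∣S∣ : ∣ R ∣ < ∣ S ∣
    ∣R∣<∣S∣ = p⊆q∧p≢q⇒∣p∣<∣q∣ (within R∈L) (λ R≡S → S∉L (subst (_∈ L) R≡S R∈L))
    0<∣S─R∣ : 0 < ∣ S ─ R ∣
    0<∣S─R∣ = +-cancelˡ-< ∣ R ∣ 0 (∣ S ─ R ∣)
      (subst₂ _<_ (sym (+-identityʳ ∣ R ∣)) (sym ∣R∣+∣S─R∣≡∣S∣) ∣R∣<∣S∣)
    ∣S─R∣<∣S∣ : ∣ S ─ R ∣ < ∣ S ∣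
    ∣S─R∣<∣S∣ = subst (∣ S ─ R ∣ <_) ∣R∣+∣S─R∣≡∣S∣ (m<n+m (∣ S ─ R ∣) 0<∣R∣)
    inner-bound : 2 * length inner < 3 * ∣ R ∣
    inner-bound = odd-laminar-bound-acc (rec ∣R∣<∣S∣) inner-family 0<∣R∣
    outer-bound : 2 * length outer < 3 * ∣ S ─ R ∣
    outer-bound = odd-laminar-bound-acc (rec ∣S─R∣<∣S∣) outer-family 0<∣S─R∣

odd-laminar-bound : {S : Subset m} {L : List (Subset m)} →
  OddLaminarFamily S L → 0 < ∣ S ∣ → 2 * length L < 3 * ∣ S ∣
odd-laminar-bound {S = S} = odd-laminar-bound-acc (<-wellFounded ∣ S ∣)

lemma6p4 : (n : ℕ) → 1 ≤ n → (ℒ : List (Subset (2 * n))) → Unique ℒ →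
    Laminar ℒ → (∀ U → U ∈ ℒ → Odd ∣ U ∣) → length ℒ ≤ 3 * n ∸ 1
lemma6p4 n 1≤n ℒ unique laminar odd = m<n⇒m≤n∸1 (*-cancelˡ-< 2 (length ℒ) (3 * n) (begin-strict
  2 * length ℒ  <⟨ odd-laminar-bound family (subst (0 <_) (sym (∣⊤∣≡n (2 * n))) (m≤n⇒m≤o*n 2 1≤n)) ⟩
  3 * ∣ ⊤ {2 * n} ∣  ≡⟨ cong (3 *_) (∣⊤∣≡n (2 * n)) ⟩
  3 * (2 * n)   ≡⟨ trans (sym (*-assoc 3 2 n)) (*-assoc 2 3 n) ⟩
  2 * (3 * n)   ∎))
  where
  open ≤-Reasoning
  family : OddLaminarFamily ⊤ ℒ
  family = record { unique = unique ; laminar = laminar ; odd = odd _ ; within = λ _ → ⊆⊤ }
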